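{- $m_7(C_3,C_3,3K_2)=2$.
   Context: $K_{j\times t}$ denotes the complete multipartite graph with $j$ partite sets, each of size $t$. For graphs $H_1,\ldots,H_k$, the multipartite Ramsey number $m_j(H_1,\ldots,H_k)$ is the smallest positive integer $t$ such that for every $k$-edge-coloring $(G^1,\ldots,G^k)$ of $K_{j\times t}$ (partition of its edges into spanning subgraphs), some $G^\ell$ contains a copy of $H_\ell$; it is $\infty$ if no such $t$ exists. $C_3$ is the triangle and $nK_2$ is a matching of $n$ edges. -}

module Defs where

open import Level using (Level; 0ℓ)
open import Data.Nat using (ℕ; zero; suc; _≤_; _<_)
open import Data.Fin using (Fin; zero; suc)
open import Data.Product using (Σ; _×_; _,_)
open import Relation.Binary.PropositionalEquality using (_≡_)
open import Relation.Nullary using (¬_)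
open import Function.Definitions using (Injective)

record Graph : Set₁ where
  field
    V   : Set
    Adj : V → V → Set
open Graph public

KV : ℕ → ℕ → Set
KV j t = Fin j × Fin t

KAdj : {j t : ℕ} → KV j t → KV j t → Set
KAdj (a , _) (b , _) = ¬ (a ≡ b)

K : ℕ → ℕ → Graph
K j t = record { V = KV j t ; Adj = KAdj }

-- A k-edge-colouring of K_{j×t}: each (unordered) edge gets exactly one colour
-- in Fin k; the colour classes are the spanning subgraphs G^1,…,G^k.
-- (Values on non-adjacent pairs are irrelevant.)
Colouring : ℕ → ℕ → ℕ → Set
Colouring j t k = Σ (KV j t → KV j t → Fin k) λ c → ∀ u v → c u v ≡ c v u

colour : {j t k : ℕ} → Colouring j t k → KV j t → KV j t → Fin k
colour (c , _) = c

ContainsCopy : {j t k : ℕ} → Colouring j t k → Fin k → Graph → Set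
ContainsCopy {j} {t} c ℓ H =
  Σ (V H → KV j t) λ f →
    Injective _≡_ _≡_ f ×
    (∀ x y → Adj H x y → KAdj (f x) (f y) × colour c (f x) (f y) ≡ ℓ)

RamseyProp : (j t k : ℕ) → (Fin k → Graph) → Set
RamseyProp j t k Hs = (c : Colouring j t k) → Σ (Fin k) λ ℓ → ContainsCopy c ℓ (Hs ℓ)

MultipartiteRamseyIs : (j k : ℕ) → (Fin k → Graph) → ℕ → Set
MultipartiteRamseyIs j k Hs m =
  1 ≤ m × RamseyProp j m k Hs × (∀ t → 1 ≤ t → t < m → ¬ RamseyProp j t k Hs)

C3 : Graph
C3 = record { V = Fin 3 ; Adj = λ x y → ¬ (x ≡ y) }

matching : ℕ → Graph
matching n = record { V = Fin n × Fin 2 ; Adj = λ { (i , x) (i' , y) → (i ≡ i') × ¬ (x ≡ y) } }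

C3C33K2 : Fin 3 → Graph
C3C33K2 zero = C3
C3C33K2 (suc zero) = C3
C3C33K2 (suc (suc zero)) = matching 3

module Submission where

-- Let E be the graph of colour-2 edges of a 3-colouring of K_{7×2} without three
-- disjoint E-edges.  Greedily build a maximal E-matching; it has at most two edges, and the
-- unmatched vertices span no E-edge.  One unmatched vertex from each of six parts spans a K₆
-- coloured 0 and 1 only, hence a monochromatic triangle since R(3,3) = 6.  Six such parts exist
-- unless the matching uses up two whole parts p and q; then every E-edge meets p or q, and an
-- exchange argument at the vertices (p , 0) and (q , 0) gives either a 3-matching or again six
-- suitable parts.
--
-- On K_{7×1} = K₇ give colour 2 to all edges at two vertices and colour the
-- remaining K₅ by a pentagon and a pentagram: no monochromatic triangle, and every colour-2 edge
-- meets one of only two vertices.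

open import Defs
open import Data.Bool using (Bool; true; false; not; if_then_else_; _∨_)
open import Data.Bool.Properties using (¬-not; ∨-comm) renaming (_≟_ to _≟ᵇ_)
open import Data.Empty using (⊥-elim)
open import Data.Fin using (Fin; zero; suc; punchIn; toℕ; fromℕ<; _≟_)
open import Data.Fin.Patterns using (0F; 1F; 2F; 3F; 4F)
open import Data.Fin.Properties
  using (any?; all?; suc-injective; punchIn-injective; punchInᵢ≢i; toℕ-injective; toℕ-fromℕ<;
         <⇒≢; pigeonhole)
open import Data.Nat using (ℕ; suc; z≤n; s≤s; _≤_; _<_; _<?_; _<ᵇ_; _≡ᵇ_; ∣_-_∣)
open import Data.Nat.Properties using (∣-∣-comm)
open import Data.Product using (Σ; ∃; ∃₂; _×_; _,_; proj₁; proj₂; map₁)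
open import Data.Product.Properties using (≡-dec)
open import Data.Sum using (_⊎_; inj₁; inj₂)
open import Data.Unit using (tt)
open import Function using (_∘_)
open import Function.Definitions using (Injective)
open import Level using (0ℓ)
open import Relation.Binary.PropositionalEquality using (_≡_; _≢_; refl; sym; trans; cong; ≢-sym)
open import Relation.Nullary using (¬_; Dec; yes; no)
open import Relation.Nullary.Decidable using (¬?; _×-dec_; _⊎-dec_; _→-dec_; map′; toWitness)
open import Relation.Unary using (Pred; Decidable)

MonochromaticTriangle : (Fin 6 → Fin 6 → Bool) → Set
MonochromaticTriangle B = Σ Bool λ v → Σ (Fin 6) λ x → Σ (Fin 6) λ y → Σ (Fin 6) λ z →
  x ≢ y × y ≢ z × x ≢ z × B x y ≡ v × B y z ≡ v × B x z ≡ v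

ThreeAlike : (Fin 5 → Bool) → Set
ThreeAlike b = Σ Bool λ v → Σ (Fin 5) λ i → Σ (Fin 5) λ j → Σ (Fin 5) λ k →
  i ≢ j × j ≢ k × i ≢ k × b i ≡ v × b j ≡ v × b k ≡ v

≢∧≢⇒≡ : ∀ {x y z : Bool} → x ≢ z → y ≢ z → x ≡ y
≢∧≢⇒≡ x≢z y≢z = trans (¬-not x≢z) (sym (¬-not y≢z))

-- An equal pair among b 2, b 3, b 4 shares its value with b 0 or with b 1, as these differ.
pair-joins : (b : Fin 5 → Bool) → b 0F ≢ b 1F → ∀ m n → m ≢ n →
             b (suc (suc m)) ≡ b (suc (suc n)) → ThreeAlike b
pair-joins b b₀≢b₁ m n m≢n bₘ≡bₙ with b (suc (suc m)) ≟ᵇ b 0F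
... | yes bₘ≡b₀ = b 0F , 0F , _ , _ , (λ ()) , m≢n ∘ suc-injective ∘ suc-injective , (λ ()) ,
                  refl , bₘ≡b₀ , trans (sym bₘ≡bₙ) bₘ≡b₀
... | no bₘ≢b₀ = b 1F , 1F , _ , _ , (λ ()) , m≢n ∘ suc-injective ∘ suc-injective , (λ ()) ,
                 refl , bₘ≡b₁ , trans (sym bₘ≡bₙ) bₘ≡b₁
  where
  bₘ≡b₁ : b (suc (suc m)) ≡ b 1F
  bₘ≡b₁ = ≢∧≢⇒≡ bₘ≢b₀ (≢-sym b₀≢b₁)

three-alike : (b : Fin 5 → Bool) → ThreeAlike b
three-alike b with b 0F ≟ᵇ b 1F
... | yes b₀≡b₁ with b 2F ≟ᵇ b 0F | b 3F ≟ᵇ b 0F | b 4F ≟ᵇ b 0F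
...   | yes b₂≡b₀ | _ | _ =
  b 0F , 0F , 1F , 2F , (λ ()) , (λ ()) , (λ ()) , refl , sym b₀≡b₁ , b₂≡b₀
...   | no _ | yes b₃≡b₀ | _ =
  b 0F , 0F , 1F , 3F , (λ ()) , (λ ()) , (λ ()) , refl , sym b₀≡b₁ , b₃≡b₀
...   | no _ | no _ | yes b₄≡b₀ =
  b 0F , 0F , 1F , 4F , (λ ()) , (λ ()) , (λ ()) , refl , sym b₀≡b₁ , b₄≡b₀
...   | no b₂≢b₀ | no b₃≢b₀ | no b₄≢b₀ =
  not (b 0F) , 2F , 3F , 4F , (λ ()) , (λ ()) , (λ ()) , ¬-not b₂≢b₀ , ¬-not b₃≢b₀ , ¬-not b₄≢b₀
three-alike b | no b₀≢b₁ with b 2F ≟ᵇ b 3F | b 2F ≟ᵇ b 4F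
... | yes b₂≡b₃ | _ = pair-joins b b₀≢b₁ 0F 1F (λ ()) b₂≡b₃
... | no _ | yes b₂≡b₄ = pair-joins b b₀≢b₁ 0F 2F (λ ()) b₂≡b₄
... | no b₂≢b₃ | no b₂≢b₄ =
  pair-joins b b₀≢b₁ 1F 2F (λ ()) (≢∧≢⇒≡ (≢-sym b₂≢b₃) (≢-sym b₂≢b₄))

-- A v-edge among the three neighbours closes a v-triangle with 0; otherwise they span a
-- triangle of the other colour.
neighbours⇒triangle : (B : Fin 6 → Fin 6 → Bool) (v : Bool) (x y z : Fin 6) →
  0F ≢ x → 0F ≢ y → 0F ≢ z → x ≢ y → y ≢ z → x ≢ z →
  B 0F x ≡ v → B 0F y ≡ v → B 0F z ≡ v → MonochromaticTriangle B
neighbours⇒triangle B v x y z 0≢x 0≢y 0≢z x≢y y≢z x≢z B₀ₓ B₀ᵧ B₀𝓏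
  with B x y ≟ᵇ v | B x z ≟ᵇ v | B y z ≟ᵇ v
... | yes Bₓᵧ | _ | _ = v , 0F , x , y , 0≢x , x≢y , 0≢y , B₀ₓ , Bₓᵧ , B₀ᵧ
... | _ | yes Bₓ𝓏 | _ = v , 0F , x , z , 0≢x , x≢z , 0≢z , B₀ₓ , Bₓ𝓏 , B₀𝓏
... | _ | _ | yes Bᵧ𝓏 = v , 0F , y , z , 0≢y , y≢z , 0≢z , B₀ᵧ , Bᵧ𝓏 , B₀𝓏
... | no Bₓᵧ | no Bₓ𝓏 | no Bᵧ𝓏 =
  not v , x , y , z , x≢y , y≢z , x≢z , ¬-not Bₓᵧ , ¬-not Bᵧ𝓏 , ¬-not Bₓ𝓏

ramsey-3-3 : (B : Fin 6 → Fin 6 → Bool) → MonochromaticTriangle B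
ramsey-3-3 B with three-alike (B 0F ∘ suc)
... | v , i , j , k , i≢j , j≢k , i≢k , B₀ᵢ , B₀ⱼ , B₀ₖ =
  neighbours⇒triangle B v (suc i) (suc j) (suc k) (λ ()) (λ ()) (λ ())
    (i≢j ∘ suc-injective) (j≢k ∘ suc-injective) (i≢k ∘ suc-injective) B₀ᵢ B₀ⱼ B₀ₖ

module _ {j t : ℕ} where

  _≟ᵥ_ : (u v : KV j t) → Dec (u ≡ v)
  _≟ᵥ_ = ≡-dec _≟_ _≟_

  KAdj⇒≢ : ∀ {u v : KV j t} → KAdj u v → u ≢ v
  KAdj⇒≢ u≁v refl = u≁v refl

module ColourClass {j t k : ℕ} (C : Colouring j t k) (ℓ : Fin k) where

  Edge : KV j t → KV j t → Set
  Edge u v = KAdj u v × colour C u v ≡ ℓ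

  edge? : ∀ u v → Dec (Edge u v)
  edge? u v = ¬? (proj₁ u ≟ proj₁ v) ×-dec (colour C u v ≟ ℓ)

  edge-sym : ∀ {u v} → Edge u v → Edge v u
  edge-sym {u} {v} (u≁v , uv≡ℓ) = u≁v ∘ sym , trans (proj₂ C v u) uv≡ℓ

  vertex? : {P : Pred (KV j t) 0ℓ} → Decidable P → Dec (∃ P)
  vertex? P? = map′ (λ (p , s , Pps) → (p , s) , Pps) (λ ((p , s) , Pps) → p , s , Pps)
                    (any? λ p → any? λ s → P? (p , s))

  Independent : Pred (KV j t) 0ℓ → Set
  Independent I = ∀ u v → I u → I v → ¬ Edge u v

  edge-or-independent : {I : Pred (KV j t) 0ℓ} → Decidable I →
                        (∃₂ λ u v → Edge u v × I u × I v) ⊎ Independent I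
  edge-or-independent I? with vertex? (λ u → vertex? (λ v → edge? u v ×-dec I? u ×-dec I? v))
  ... | yes (u , v , uv , Iu , Iv) = inj₁ (u , v , uv , Iu , Iv)
  ... | no ∄edge = inj₂ λ u v Iu Iv uv → ∄edge (u , v , uv , Iu , Iv)

  independent-insert : ∀ {I : Pred (KV j t) 0ℓ} x → Independent I → (∀ v → I v → ¬ Edge x v) →
                       Independent (λ u → u ≡ x ⊎ I u)
  independent-insert x _ _ u v (inj₁ refl) (inj₁ refl) (x≁x , _) = x≁x refl
  independent-insert x _ x-isolated u v (inj₁ refl) (inj₂ Iv) = x-isolated v Iv
  independent-insert x _ x-isolated u v (inj₂ Iu) (inj₁ refl) = x-isolated u Iu ∘ edge-sym
  independent-insert x I-ind _ u v (inj₂ Iu) (inj₂ Iv) = I-ind u v Iu Iv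

  record Matching (n : ℕ) : Set where
    field
      endpoint : Fin n × Fin 2 → KV j t
      endpoint-injective : Injective _≡_ _≡_ endpoint
      edge : ∀ i → Edge (endpoint (i , 0F)) (endpoint (i , 1F))

  open Matching

  -- A record rather than a function type, so that Agda can invert Free (extend M …) u.
  record Free {n} (M : Matching n) (u : KV j t) : Set where
    constructor free
    field avoids : ∀ i s → u ≢ endpoint M (i , s)

  open Free

  free? : ∀ {n} (M : Matching n) → Decidable (Free M)
  free? M u = map′ free avoids (all? λ i → all? λ s → ¬? (u ≟ᵥ endpoint M (i , s)))

  empty : Matching 0
  empty = record { endpoint = λ () ; endpoint-injective = λ {} ; edge = λ () }

  free-empty : ∀ u → Free empty u
  free-empty u = free λ ()

  extend : ∀ {n u v} (M : Matching n) → Edge u v → Free M u → Free M v → Matching (suc n)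
  extend {n} {u} {v} M uv u-free v-free = record
    { endpoint = endpoint′ ; endpoint-injective = injective′ ; edge = edge′ }
    where
    endpoint′ : Fin (suc n) × Fin 2 → KV j t
    endpoint′ (zero , 0F) = u
    endpoint′ (zero , 1F) = v
    endpoint′ (suc i , s) = endpoint M (i , s)

    injective′ : Injective _≡_ _≡_ endpoint′
    injective′ {zero , 0F} {zero , 0F} _ = refl
    injective′ {zero , 0F} {zero , 1F} u≡v = ⊥-elim (KAdj⇒≢ (proj₁ uv) u≡v)
    injective′ {zero , 1F} {zero , 0F} v≡u = ⊥-elim (KAdj⇒≢ (proj₁ uv) (sym v≡u))
    injective′ {zero , 1F} {zero , 1F} _ = refl
    injective′ {zero , 0F} {suc i , s} u≡ = ⊥-elim (avoids u-free i s u≡)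
    injective′ {zero , 1F} {suc i , s} v≡ = ⊥-elim (avoids v-free i s v≡)
    injective′ {suc i , s} {zero , 0F} ≡u = ⊥-elim (avoids u-free i s (sym ≡u))
    injective′ {suc i , s} {zero , 1F} ≡v = ⊥-elim (avoids v-free i s (sym ≡v))
    injective′ {suc i , s} {suc i′ , s′} eq = cong (map₁ suc) (endpoint-injective M eq)

    edge′ : ∀ i → Edge (endpoint′ (i , 0F)) (endpoint′ (i , 1F))
    edge′ zero = uv
    edge′ (suc i) = edge M i

  free-extend : ∀ {n u v w} {M : Matching n} {uv : Edge u v} {u-free : Free M u}
                {v-free : Free M v} → w ≢ u → w ≢ v → Free M w → Free (extend M uv u-free v-free) w
  free-extend {w = w} {M} {uv} {u-free} {v-free} w≢u w≢v w-free = free avoids′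
    where
    avoids′ : ∀ i s → w ≢ endpoint (extend M uv u-free v-free) (i , s)
    avoids′ zero 0F = w≢u
    avoids′ zero 1F = w≢v
    avoids′ (suc i) s = avoids w-free i s

  matching⇒copy : ∀ {n} → Matching n → ContainsCopy C ℓ (matching n)
  matching⇒copy {n} M = endpoint M , endpoint-injective M , adjacent
    where
    adjacent : ∀ x y → Adj (matching n) x y → Edge (endpoint M x) (endpoint M y)
    adjacent (i , 0F) (.i , 0F) (refl , 0≢0) = ⊥-elim (0≢0 refl)
    adjacent (i , 0F) (.i , 1F) (refl , _) = edge M i
    adjacent (i , 1F) (.i , 0F) (refl , _) = edge-sym (edge M i)
    adjacent (i , 1F) (.i , 1F) (refl , 1≢1) = ⊥-elim (1≢1 refl)

  triangle⇒copy : ∀ {x y z} → Edge x y → Edge y z → Edge x z → ContainsCopy C ℓ C3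
  triangle⇒copy {x} {y} {z} xy yz xz = vertex , injective , adjacent
    where
    vertex : Fin 3 → KV j t
    vertex 0F = x
    vertex 1F = y
    vertex 2F = z

    adjacent : ∀ i i′ → i ≢ i′ → Edge (vertex i) (vertex i′)
    adjacent 0F 1F _ = xy
    adjacent 0F 2F _ = xz
    adjacent 1F 0F _ = edge-sym xy
    adjacent 1F 2F _ = yz
    adjacent 2F 0F _ = edge-sym xz
    adjacent 2F 1F _ = edge-sym yz
    adjacent 0F 0F i≢i = ⊥-elim (i≢i refl)
    adjacent 1F 1F i≢i = ⊥-elim (i≢i refl)
    adjacent 2F 2F i≢i = ⊥-elim (i≢i refl)

    injective : Injective _≡_ _≡_ vertex
    injective {i} {i′} eq with i ≟ i′
    ... | yes i≡i′ = i≡i′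
    ... | no i≢i′ = ⊥-elim (KAdj⇒≢ (proj₁ (adjacent i i′ i≢i′)) eq)

  copy⇒triangle : ContainsCopy C ℓ C3 → ∃ λ x → ∃₂ λ y z → Edge x y × Edge y z × Edge x z
  copy⇒triangle (f , _ , adjacent) =
    f 0F , f 1F , f 2F , adjacent 0F 1F (λ ()) , adjacent 1F 2F (λ ()) , adjacent 0F 2F (λ ())

HasMonochromaticCopy : ∀ {j t} → Colouring j t 3 → Set
HasMonochromaticCopy C = Σ (Fin 3) λ ℓ → ContainsCopy C ℓ (C3C33K2 ℓ)

isZero : Fin 3 → Bool
isZero 0F = true
isZero _ = false

fromBool : Bool → Fin 3
fromBool true = 0F
fromBool false = 1F

fromBool-isZero : ∀ c → c ≢ 2F → fromBool (isZero c) ≡ c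
fromBool-isZero 0F _ = refl
fromBool-isZero 1F _ = refl
fromBool-isZero 2F c≢2 = ⊥-elim (c≢2 refl)

module _ {j t : ℕ} (C : Colouring j t 3) where
  open ColourClass C 2F using (Edge)

  triangle⇒monochromatic : ∀ v {x y z} → ColourClass.Edge C (fromBool v) x y →
                           ColourClass.Edge C (fromBool v) y z →
                           ColourClass.Edge C (fromBool v) x z → HasMonochromaticCopy C
  triangle⇒monochromatic true xy yz xz = 0F , ColourClass.triangle⇒copy C 0F xy yz xz
  triangle⇒monochromatic false xy yz xz = 1F , ColourClass.triangle⇒copy C 1F xy yz xz

  sextuple⇒monochromatic : (f : Fin 6 → KV j t) →
    (∀ k l → k ≢ l → KAdj (f k) (f l)) → (∀ k l → k ≢ l → ¬ Edge (f k) (f l)) →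
    HasMonochromaticCopy C
  sextuple⇒monochromatic f adjacent independent
    with ramsey-3-3 (λ k l → isZero (colour C (f k) (f l)))
  ... | v , x , y , z , x≢y , y≢z , x≢z , Bxy , Byz , Bxz =
    triangle⇒monochromatic v (edge x≢y Bxy) (edge y≢z Byz) (edge x≢z Bxz)
    where
    edge : ∀ {k l} → k ≢ l → isZero (colour C (f k) (f l)) ≡ v →
           KAdj (f k) (f l) × colour C (f k) (f l) ≡ fromBool v
    edge {k} {l} k≢l B≡v =
      adjacent k l k≢l ,
      trans (sym (fromBool-isZero _ (independent k l k≢l ∘ (adjacent k l k≢l ,_))))
            (cong fromBool B≡v)

module UpperBound (C : Colouring 7 2 3) where
  open ColourClass C 2F

  transversal⇒monochromatic : ∀ {I : Pred (KV 7 2) 0ℓ} → Independent I → (q : Fin 7) →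
                              (∀ r → r ≢ q → ∃ λ s → I (r , s)) → HasMonochromaticCopy C
  transversal⇒monochromatic {I} I-ind q hits =
    sextuple⇒monochromatic C vertex adjacent independent
    where
    representative : ∀ k → ∃ λ s → I (punchIn q k , s)
    representative k = hits (punchIn q k) (punchInᵢ≢i q k)

    vertex : Fin 6 → KV 7 2
    vertex k = punchIn q k , proj₁ (representative k)

    adjacent : ∀ k l → k ≢ l → KAdj (vertex k) (vertex l)
    adjacent k l k≢l = k≢l ∘ punchIn-injective q k l

    independent : ∀ k l → k ≢ l → ¬ Edge (vertex k) (vertex l)
    independent k l _ = I-ind _ _ (proj₂ (representative k)) (proj₂ (representative l))

  avoid-pair : ∀ {u v : KV 7 2} → KAdj u v → ∀ r → ∃ λ s → (r , s) ≢ u × (r , s) ≢ v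
  avoid-pair {u} {v} u≁v r with (r , 0F) ≟ᵥ u | (r , 0F) ≟ᵥ v
  ... | no ≢u | no ≢v = 0F , ≢u , ≢v
  ... | yes refl | _ = 1F , (λ ()) , λ { refl → u≁v refl }
  ... | no _ | yes refl = 1F , (λ { refl → u≁v refl }) , λ ()

  other : Fin 2 → Fin 2
  other 0F = 1F
  other 1F = 0F

  other-≢ : ∀ s → other s ≢ s
  other-≢ 0F ()
  other-≢ 1F ()

  ≢-part : ∀ {r r′ : Fin 7} {s s′ : Fin 2} → r ≢ r′ → (r , s) ≢ (r′ , s′)
  ≢-part r≢r′ = r≢r′ ∘ cong proj₁

  Outside : Fin 7 → Fin 7 → Pred (KV 7 2) 0ℓ
  Outside p q u = proj₁ u ≢ p × proj₁ u ≢ q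

  outside? : ∀ p q → Decidable (Outside p q)
  outside? p q u = ¬? (proj₁ u ≟ p) ×-dec ¬? (proj₁ u ≟ q)

  module _ {p q : Fin 7} where

    outside-≢ₗ : ∀ {u s} → Outside p q u → u ≢ (p , s)
    outside-≢ₗ (u≁p , _) = u≁p ∘ cong proj₁

    outside-≢ᵣ : ∀ {u s} → Outside p q u → u ≢ (q , s)
    outside-≢ᵣ (_ , u≁q) = u≁q ∘ cong proj₁

  -- Either (q , 0) has no neighbour outside the parts p, q, or it has one, w, and then (p , 0)
  -- has none besides w, unless (p , 1) (q , 1), (q , 0) w and (p , 0) x form a 3-matching.
  two-part-cover⇒monochromatic : ∀ {p q} → p ≢ q → Edge (p , 1F) (q , 1F) →
                                 Independent (Outside p q) → HasMonochromaticCopy C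
  two-part-cover⇒monochromatic {p} {q} p≢q cd outside-ind
    with vertex? (λ w → outside? p q w ×-dec edge? (q , 0F) w)
  ... | no b-isolated = transversal⇒monochromatic I-ind p hits
    where
    I-ind : Independent (λ u → u ≡ (q , 0F) ⊎ Outside p q u)
    I-ind = independent-insert (q , 0F) outside-ind λ w w-out bw → b-isolated (w , w-out , bw)

    hits : ∀ r → r ≢ p → ∃ λ s → (r , s) ≡ (q , 0F) ⊎ Outside p q (r , s)
    hits r r≢p with r ≟ q
    ... | yes refl = 0F , inj₁ refl
    ... | no r≢q = 0F , inj₂ (r≢p , r≢q)
  ... | yes (w , w-out , bw)
    with vertex? (λ x → outside? p q x ×-dec ¬? (x ≟ᵥ w) ×-dec edge? (p , 0F) x)
  ...   | yes (x , x-out , x≢w , ax) = 2F , matching⇒copy M₃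
    where
    M₁ : Matching 1
    M₁ = extend empty cd (free-empty _) (free-empty _)

    M₂ : Matching 2
    M₂ = extend M₁ bw (free-extend (≢-part (≢-sym p≢q)) (λ ()) (free-empty _))
                      (free-extend (outside-≢ₗ w-out) (outside-≢ᵣ w-out) (free-empty _))

    M₃ : Matching 3
    M₃ = extend M₂ ax (free-extend (≢-part p≢q) (≢-sym (outside-≢ₗ w-out))
                        (free-extend (λ ()) (≢-part p≢q) (free-empty _)))
                      (free-extend (outside-≢ᵣ x-out) x≢w
                        (free-extend (outside-≢ₗ x-out) (outside-≢ᵣ x-out) (free-empty _)))
  ...   | no a-isolated = transversal⇒monochromatic I-ind q hits
    where
    I : Pred (KV 7 2) 0ℓ
    I u = u ≡ (p , 0F) ⊎ (Outside p q u × u ≢ w)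

    I-ind : Independent I
    I-ind = independent-insert (p , 0F) (λ u v Iu Iv → outside-ind u v (proj₁ Iu) (proj₁ Iv))
                               λ x (x-out , x≢w) ax → a-isolated (x , x-out , x≢w , ax)

    hits : ∀ r → r ≢ q → ∃ λ s → I (r , s)
    hits r r≢q with r ≟ p
    ... | yes refl = 0F , inj₁ refl
    ... | no r≢p = other (proj₂ w) , inj₂ ((r≢p , r≢q) , other-≢ (proj₂ w) ∘ cong proj₂)

  single : ∀ {a b} → Edge a b → Matching 1
  single ab = extend empty ab (free-empty _) (free-empty _)

  module MaximalPair {p q c d} (ab : Edge (p , 0F) (q , 0F)) (cd : Edge c d)
                     (c-free : Free (single ab) c) (d-free : Free (single ab) d)
                     (maximal : Independent (Free (extend (single ab) cd c-free d-free))) where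

    M₂ : Matching 2
    M₂ = extend (single ab) cd c-free d-free

    free₂ : ∀ {u} → u ≢ (p , 0F) → u ≢ (q , 0F) → u ≢ c → u ≢ d → Free M₂ u
    free₂ u≢a u≢b u≢c u≢d = free-extend u≢c u≢d (free-extend u≢a u≢b (free-empty _))

    -- For x = p, q the vertex (x , 0) is matched by ab, so part x is used up iff (x , 1) is
    -- c or d.
    UsedUp : Fin 7 → Set
    UsedUp x = (x , 1F) ≡ c ⊎ (x , 1F) ≡ d

    usedUp? : ∀ x → Dec (UsedUp x)
    usedUp? x = (x , 1F) ≟ᵥ c ⊎-dec (x , 1F) ≟ᵥ d

    hit : ∀ r → (r ≡ p → ¬ UsedUp p) → (r ≡ q → ¬ UsedUp q) → ∃ λ s → Free M₂ (r , s)
    hit r p-available q-available with r ≟ p | r ≟ q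
    ... | yes refl | _ =
      1F , free₂ (λ ()) (λ ()) (p-available refl ∘ inj₁) (p-available refl ∘ inj₂)
    ... | no _ | yes refl =
      1F , free₂ (λ ()) (λ ()) (q-available refl ∘ inj₁) (q-available refl ∘ inj₂)
    ... | no r≢p | no r≢q with avoid-pair (proj₁ cd) r
    ...   | s , ≢c , ≢d = s , free₂ (≢-part r≢p) (≢-part r≢q) ≢c ≢d

    monochromatic : HasMonochromaticCopy C
    monochromatic with usedUp? p | usedUp? q
    ... | no p-available | _ =
      transversal⇒monochromatic maximal q λ r r≢q → hit r (λ _ → p-available) (⊥-elim ∘ r≢q)
    ... | _ | no q-available =
      transversal⇒monochromatic maximal p λ r r≢p → hit r (⊥-elim ∘ r≢p) (λ _ → q-available)
    ... | yes (inj₁ refl) | yes (inj₂ refl) =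
      two-part-cover⇒monochromatic (proj₁ ab) cd
        λ u v u-out v-out → maximal u v (outside-free u-out) (outside-free v-out)
      where
      outside-free : ∀ {u} → Outside p q u → Free M₂ u
      outside-free out = free₂ (outside-≢ₗ out) (outside-≢ᵣ out) (outside-≢ₗ out) (outside-≢ᵣ out)
    ... | yes (inj₂ refl) | yes (inj₁ refl) =
      two-part-cover⇒monochromatic (proj₁ ab) (edge-sym cd)
        λ u v u-out v-out → maximal u v (outside-free u-out) (outside-free v-out)
      where
      outside-free : ∀ {u} → Outside p q u → Free M₂ u
      outside-free out = free₂ (outside-≢ₗ out) (outside-≢ᵣ out) (outside-≢ᵣ out) (outside-≢ₗ out)
    ... | yes (inj₁ refl) | yes (inj₁ q≡p) = ⊥-elim (proj₁ ab (sym (cong proj₁ q≡p)))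
    ... | yes (inj₂ refl) | yes (inj₂ q≡p) = ⊥-elim (proj₁ ab (sym (cong proj₁ q≡p)))

  -- A with-abstraction over the search below makes type checking blow up; hence the helpers.
  two-edges⇒monochromatic : ∀ {p q c d} (ab : Edge (p , 0F) (q , 0F)) (cd : Edge c d) →
                            Free (single ab) c → Free (single ab) d → HasMonochromaticCopy C
  two-edges⇒monochromatic ab cd c-free d-free = augment-or-maximal (edge-or-independent (free? M₂))
    where
    M₂ : Matching 2
    M₂ = extend (single ab) cd c-free d-free

    augment-or-maximal : (∃₂ λ e f → Edge e f × Free M₂ e × Free M₂ f) ⊎ Independent (Free M₂) →
                         HasMonochromaticCopy C
    augment-or-maximal (inj₁ (_ , _ , ef , e-free , f-free)) =
      2F , matching⇒copy (extend M₂ ef e-free f-free)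
    augment-or-maximal (inj₂ maximal) = MaximalPair.monochromatic ab cd c-free d-free maximal

  one-edge⇒monochromatic : ∀ {p q} → Edge (p , 0F) (q , 0F) → HasMonochromaticCopy C
  one-edge⇒monochromatic ab = augment-or-maximal (edge-or-independent (free? (single ab)))
    where
    hit : ∀ r → ∃ λ s → Free (single ab) (r , s)
    hit r with avoid-pair (proj₁ ab) r
    ... | s , ≢a , ≢b = s , free-extend ≢a ≢b (free-empty _)

    augment-or-maximal : (∃₂ λ c d → Edge c d × Free (single ab) c × Free (single ab) d) ⊎
                         Independent (Free (single ab)) → HasMonochromaticCopy C
    augment-or-maximal (inj₁ (_ , _ , cd , c-free , d-free)) =
      two-edges⇒monochromatic ab cd c-free d-free
    augment-or-maximal (inj₂ maximal) = transversal⇒monochromatic maximal 0F λ r _ → hit r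

  BottomRow : Pred (KV 7 2) 0ℓ
  BottomRow u = proj₂ u ≡ 0F

  -- The first matching edge is taken inside the bottom row, so that a used-up part p, q is
  -- recognised by (p , 1) or (q , 1) alone.
  monochromatic : HasMonochromaticCopy C
  monochromatic = edge-or-transversal (edge-or-independent (λ u → proj₂ u ≟ 0F))
    where
    edge-or-transversal : (∃₂ λ a b → Edge a b × BottomRow a × BottomRow b) ⊎
                          Independent BottomRow → HasMonochromaticCopy C
    edge-or-transversal (inj₁ ((_ , _) , (_ , _) , ab , refl , refl)) = one-edge⇒monochromatic ab
    edge-or-transversal (inj₂ bottom-row-independent) =
      transversal⇒monochromatic bottom-row-independent 0F λ r _ → 0F , refl

-- ∣ p - q ∣ ∈ {1, 4} is the 5-cycle 2 3 4 5 6 on the vertices 2, …, 6.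
lowerColour : Fin 7 → Fin 7 → Fin 3
lowerColour p q =
  if (toℕ p <ᵇ 2) ∨ (toℕ q <ᵇ 2) then 2F
  else if (∣ toℕ p - toℕ q ∣ ≡ᵇ 1) ∨ (∣ toℕ p - toℕ q ∣ ≡ᵇ 4) then 0F
  else 1F

lowerColour-comm : ∀ p q → lowerColour p q ≡ lowerColour q p
lowerColour-comm p q rewrite ∨-comm (toℕ p <ᵇ 2) (toℕ q <ᵇ 2) | ∣-∣-comm (toℕ p) (toℕ q) = refl

lowerColouring : Colouring 7 1 3
lowerColouring =
  (λ u v → lowerColour (proj₁ u) (proj₁ v)) , λ u v → lowerColour-comm (proj₁ u) (proj₁ v)

LowerTriangle : Fin 3 → Fin 7 → Fin 7 → Fin 7 → Set
LowerTriangle ℓ p q r =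
  p ≢ q × q ≢ r × p ≢ r × lowerColour p q ≡ ℓ × lowerColour q r ≡ ℓ × lowerColour p r ≡ ℓ

lowerTriangle? : ∀ ℓ p q r → Dec (LowerTriangle ℓ p q r)
lowerTriangle? ℓ p q r = ¬? (p ≟ q) ×-dec ¬? (q ≟ r) ×-dec ¬? (p ≟ r) ×-dec
  (lowerColour p q ≟ ℓ) ×-dec (lowerColour q r ≟ ℓ) ×-dec (lowerColour p r ≟ ℓ)

pentagon-triangle-free : ∀ ℓ → ℓ ≢ 2F → ∀ p q r → ¬ LowerTriangle ℓ p q r
pentagon-triangle-free = toWitness {a? = all? λ ℓ → ¬? (ℓ ≟ 2F) →-dec
  (all? λ p → all? λ q → all? λ r → ¬? (lowerTriangle? ℓ p q r))} tt

colour₂-small : ∀ p q → lowerColour p q ≡ 2F → toℕ p < 2 ⊎ toℕ q < 2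
colour₂-small = toWitness {a? = all? λ p → all? λ q →
  (lowerColour p q ≟ 2F) →-dec (toℕ p <? 2 ⊎-dec toℕ q <? 2)} tt

lower-triangle-free : ∀ ℓ → ℓ ≢ 2F → ¬ ContainsCopy lowerColouring ℓ C3
lower-triangle-free ℓ ℓ≢2 copy with ColourClass.copy⇒triangle lowerColouring ℓ copy
... | (p , _) , (q , _) , (r , _) , (p≢q , pq) , (q≢r , qr) , (p≢r , pr) =
  pentagon-triangle-free ℓ ℓ≢2 p q r (p≢q , q≢r , p≢r , pq , qr , pr)

-- Each of the three disjoint colour-2 edges has an end in {0, 1}: pigeonhole.
lower-matching-free : ¬ ContainsCopy lowerColouring 2F (matching 3)
lower-matching-free (f , f-injective , adjacent) =
  let i , j , i<j , same-end = pigeonhole (s≤s (s≤s (s≤s z≤n))) end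
  in <⇒≢ i<j (end-injective same-end)
  where
  small-end : ∀ i → ∃ λ s → toℕ (proj₁ (f (i , s))) < 2
  small-end i with colour₂-small _ _ (proj₂ (adjacent (i , 0F) (i , 1F) (refl , λ ())))
  ... | inj₁ p<2 = 0F , p<2
  ... | inj₂ q<2 = 1F , q<2

  end : Fin 3 → Fin 2
  end i = fromℕ< (proj₂ (small-end i))

  same-vertex : ∀ {u v : KV 7 1} → proj₁ u ≡ proj₁ v → u ≡ v
  same-vertex {_ , zero} {_ , zero} refl = refl

  end-injective : ∀ {i j} → end i ≡ end j → i ≡ j
  end-injective same-end = cong proj₁ (f-injective (same-vertex (toℕ-injective
    (trans (sym (toℕ-fromℕ< _)) (trans (cong toℕ same-end) (toℕ-fromℕ< _))))))

lower : ¬ RamseyProp 7 1 3 C3C33K2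
lower ramsey with ramsey lowerColouring
... | 0F , copy = lower-triangle-free 0F (λ ()) copy
... | 1F , copy = lower-triangle-free 1F (λ ()) copy
... | 2F , copy = lower-matching-free copy

lemma2 : MultipartiteRamseyIs 7 3 C3C33K2 2
lemma2 = s≤s z≤n , UpperBound.monochromatic , below
  where
  below : ∀ t → 1 ≤ t → t < 2 → ¬ RamseyProp 7 t 3 C3C33K2
  below 1 _ _ = lower
  below (suc (suc _)) _ (s≤s (s≤s ()))
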